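{- Let $\Psi$ be an arithmetic circuit computing $f\in\mathbb{F}[z_1,\ldots,z_n]$, let $f_\Psi=\sum_{m}v_mm$ be its coefficient-vector polynomial, and suppose $w$ is a basis isolating weight assignment for $f_\Psi$. Let $\phi$ be the substitution sending $z_i\mapsto t^{w(z_i)}$ for a new variable $t$. Then $\phi(f)\not\equiv0$ if and only if $f\not\equiv0$.
   Context: $Z=\{z_1,\ldots,z_n\}$ are commuting variables, $\mathrm{mons}(Z)$ the set of monomials. An arithmetic circuit over $\mathbb{F}[Z]$ is a DAG with leaves labeled by variables or field elements and internal sum and product gates; $f$ is the polynomial at the output gate. If $\Psi$ has $s$ gates, $f_\Psi=\sum_{m\in\mathrm{mons}(Z)}v_mm\in\mathbb{F}^s[Z]$, where $v_m\in\mathbb{F}^s$ is indexed by gates and $v_m(g)$ is the coefficient of $m$ in the polynomial computed at gate $g$. A weight function $w:Z\to\mathbb{N}$ extends to monomials by $w(z_1^{i_1}\cdots z_n^{i_n})=\sum_ji_jw(z_j)$. $w$ is a basis isolating weight assignment for $f_\Psi$ if there is a set $M\subseteq\mathrm{mons}(Z)$ such that: (1) $\{v_m:m\in M\}$ is a basis of $\mathrm{span}\{v_m:m\in\mathrm{mons}(Z)\}$; (2) $w(m)\ne w(m')$ for distinct $m,m'\in M$; (3) for each $m\notin M$, $v_m\in\mathrm{span}\{v_{m'}:m'\in M,\ w(m')<w(m)\}$. -}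

module Defs where

open import Level using (Level; _⊔_)
open import Data.Nat as ℕ using (ℕ; zero; suc; _<_; _<?_)
open import Data.Fin using (Fin; zero; suc)
open import Data.Vec as Vec using (Vec; []; _∷_)
open import Data.Vec.Properties using (≡-dec)
open import Data.List as List using (List; []; _∷_; _++_; length; lookup; filter)
open import Data.List.Membership.Propositional using (_∈_; _∉_)
open import Data.Product using (Σ; _×_; _,_)
open import Relation.Nullary using (¬_; Dec; yes; no)
open import Relation.Binary.PropositionalEquality using (_≡_; _≢_)
open import Algebra.Bundles using (CommutativeRing)

record Field (c ℓ : Level) : Set (Level.suc (c ⊔ ℓ)) where
  field
    commutativeRing : CommutativeRing c ℓ
  open CommutativeRing commutativeRing public
  field
    0≉1     : ¬ (0# ≈ 1#)
    inverse : ∀ x → ¬ (x ≈ 0#) → Σ Carrier λ y → (x * y) ≈ 1#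

module FieldDefs {c ℓ : Level} (F : Field c ℓ) where
  open Field F using (Carrier; _≈_; _+_; _*_; 0#; 1#)

  ∑ : ∀ {k} → (Fin k → Carrier) → Carrier
  ∑ {zero}  f = 0#
  ∑ {suc k} f = f zero + ∑ (λ i → f (suc i))

  -- Polynomials in z₁ … zₙ: a monomial z₁^{i₁}⋯zₙ^{iₙ} is its exponent
  -- vector; a polynomial is a formal finite sum of terms (coefficient,
  -- monomial); equality of polynomials is equality of all coefficients.

  Mon : ℕ → Set
  Mon n = Vec ℕ n

  Poly : ℕ → Set c
  Poly n = List (Carrier × Mon n)

  unitMon : ∀ {n} → Fin n → Mon n
  unitMon {suc n} zero    = 1 ∷ Vec.replicate n 0
  unitMon {suc n} (suc i) = 0 ∷ unitMon i

  varP : ∀ {n} → Fin n → Poly n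
  varP i = (1# , unitMon i) ∷ []

  constP : ∀ {n} → Carrier → Poly n
  constP a = (a , Vec.replicate _ 0) ∷ []

  addP : ∀ {n} → Poly n → Poly n → Poly n
  addP p q = p ++ q

  mulP : ∀ {n} → Poly n → Poly n → Poly n
  mulP p q = List.concatMap (λ { (a , e) → List.map (λ { (b , e') → (a * b , Vec.zipWith ℕ._+_ e e') }) q }) p

  coef : ∀ {n} → Poly n → Mon n → Carrier
  coef [] m = 0#
  coef ((a , e) ∷ p) m with ≡-dec ℕ._≟_ e m
  ... | yes _ = a + coef p m
  ... | no  _ = coef p m

  IsZero : ∀ {n} → Poly n → Set ℓ
  IsZero p = ∀ m → coef p m ≈ 0#

  UPoly : Set c
  UPoly = List (Carrier × ℕ)

  ucoef : UPoly → ℕ → Carrier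
  ucoef [] d = 0#
  ucoef ((a , e) ∷ p) d with e ℕ.≟ d
  ... | yes _ = a + ucoef p d
  ... | no  _ = ucoef p d

  UIsZero : UPoly → Set ℓ
  UIsZero p = ∀ d → ucoef p d ≈ 0#

  weight : ∀ {n} → (Fin n → ℕ) → Mon n → ℕ
  weight w m = Vec.sum (Vec.zipWith ℕ._*_ m (Vec.tabulate w))

  φ : ∀ {n} → (Fin n → ℕ) → Poly n → UPoly
  φ w p = List.map (λ { (a , e) → (a , weight w e) }) p

  -- A circuit with k gates is built by adding
  -- gates one at a time; a new gate may be a leaf (variable or field
  -- element) or a sum/product gate whose two inputs are among the k
  -- gates already present (so the graph is a DAG).  Gate `zero` is the
  -- most recently added one.

  data Gate (n k : ℕ) : Set c where
    var   : Fin n → Gate n k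
    const : Carrier → Gate n k
    plus  : Fin k → Fin k → Gate n k
    times : Fin k → Fin k → Gate n k

  data Circuit (n : ℕ) : ℕ → Set c where
    []  : Circuit n 0
    _∷_ : ∀ {k} → Gate n k → Circuit n k → Circuit n (suc k)

  gatePoly : ∀ {n k} → (Fin k → Poly n) → Gate n k → Poly n
  gatePoly ev (var i)     = varP i
  gatePoly ev (const a)   = constP a
  gatePoly ev (plus g h)  = addP (ev g) (ev h)
  gatePoly ev (times g h) = mulP (ev g) (ev h)

  eval : ∀ {n s} → Circuit n s → Fin s → Poly n
  eval (g ∷ C) zero    = gatePoly (eval C) g
  eval (g ∷ C) (suc i) = eval C i

  Vecᶠ : ℕ → Set c
  Vecᶠ s = Fin s → Carrier

  linComb : ∀ {s} (L : List (Vecᶠ s)) → (Fin (length L) → Carrier) → Vecᶠ s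
  linComb L cs g = ∑ (λ i → cs i * lookup L i g)

  InSpan : ∀ {s} → List (Vecᶠ s) → Vecᶠ s → Set (c ⊔ ℓ)
  InSpan L v = Σ (Fin (length L) → Carrier) λ cs → ∀ g → v g ≈ linComb L cs g

  LinIndep : ∀ {s} → List (Vecᶠ s) → Set (c ⊔ ℓ)
  LinIndep L = ∀ cs → (∀ g → linComb L cs g ≈ 0#) → ∀ i → cs i ≈ 0#

  -- f_Ψ = Σ_m v_m m : v_m(g) = coefficient of m at gate g

  coefVec : ∀ {n s} → Circuit n s → Mon n → Vecᶠ s
  coefVec C m g = coef (eval C g) m

  BasisIsolating : ∀ {n s} → Circuit n s → (Fin n → ℕ) → Set (c ⊔ ℓ)
  BasisIsolating {n} C w = Σ (List (Mon n)) λ M →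
      (LinIndep (List.map v M) × (∀ m → InSpan (List.map v M) (v m)))
    × (∀ m m' → m ∈ M → m' ∈ M → m ≢ m' → weight w m ≢ weight w m')
    × (∀ m → m ∉ M →
         InSpan (List.map v (filter (λ m' → weight w m' <? weight w m) M)) (v m))
    where
    v : Mon n → Vecᶠ _
    v = coefVec C

{-# OPTIONS --safe #-}
module Submission where

-- For every d, the coefficient of t^d in φ(p) is the sum of the coefficients
-- of the monomials of weight d in p; in particular φ(0) = 0.  Conversely, if
-- φ(f) = 0 for the polynomial f at some gate, we show by well-founded
-- induction on the weight that f has coefficient 0 at every monomial m of the
-- isolating basis M.  Any other monomial e with w(e) = w(m) lies outside M,
-- since weights on M are distinct, so v_e is a combination of basis vectors
-- v_m' with w(m') < w(m); their coordinates at the gate vanish by induction,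
-- hence so does that of v_e.  So the coefficient of t^(w(m)) in φ(f) is just
-- the coefficient of m in f, which is 0.  Finally every v_m lies in the span
-- of the basis vectors, so every coefficient of f vanishes.

open import Defs
open import Level using (Level)
open import Data.Nat using (ℕ; _≟_; _≤_; _<_; _<?_; z≤n; s≤s)
open import Data.Nat.Properties using (m≤n⇒m≤1+n)
open import Data.Nat.Induction using (<-wellFounded)
open import Data.Fin as Fin using (Fin)
open import Data.Vec.Properties using (≡-dec)
open import Data.List using (List; []; _∷_; length; filter)
open import Data.List.Membership.Propositional using (_∈_)
open import Data.List.Membership.Propositional.Properties using (∈-filter⁻)
import Data.List.Membership.DecPropositional as DecMembership
open import Data.List.Relation.Unary.All as All using (All; []; _∷_)
open import Data.List.Relation.Unary.All.Properties using (map⁺)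
open import Data.Product using (_,_)
open import Data.Empty using (⊥-elim)
open import Function using (_on_)
open import Function.Bundles using (_⇔_; mk⇔)
open import Induction.WellFounded using (WellFounded; Acc; acc)
open import Relation.Binary.Construct.On as On using ()
open import Relation.Nullary using (¬_; Dec; yes; no; contraposition)
open import Relation.Binary.PropositionalEquality using (_≡_; _≢_; refl; subst)
import Algebra.Properties.CommutativeSemigroup as CommSemigroupProperties
import Relation.Binary.Reasoning.Setoid as SetoidReasoning

module _ {c ℓ : Level} (F : Field c ℓ) where
  open Field F hiding (zero) renaming (refl to ≈-refl)
  open FieldDefs F
  open CommSemigroupProperties +-commutativeSemigroup using (x∙yz≈y∙xz)
  open SetoidReasoning setoid

  dropMon : ∀ {n} → Mon n → Poly n → Poly n
  dropMon e₀ [] = []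
  dropMon e₀ ((a , e) ∷ p) with ≡-dec _≟_ e e₀
  ... | yes _ = dropMon e₀ p
  ... | no  _ = (a , e) ∷ dropMon e₀ p

  module _ {n : ℕ} where

    length-dropMon : ∀ e₀ (p : Poly n) → length (dropMon e₀ p) ≤ length p
    length-dropMon e₀ [] = z≤n
    length-dropMon e₀ ((a , e) ∷ p) with ≡-dec _≟_ e e₀
    ... | yes _ = m≤n⇒m≤1+n (length-dropMon e₀ p)
    ... | no  _ = s≤s (length-dropMon e₀ p)

    length-dropMon-head : ∀ a e (p : Poly n) → length (dropMon e ((a , e) ∷ p)) < length ((a , e) ∷ p)
    length-dropMon-head a e p with ≡-dec _≟_ e e
    ... | yes _   = s≤s (length-dropMon e p)
    ... | no  e≢e = ⊥-elim (e≢e refl)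

    coef-dropMon-≡ : ∀ e₀ (p : Poly n) → coef (dropMon e₀ p) e₀ ≈ 0#
    coef-dropMon-≡ e₀ [] = ≈-refl
    coef-dropMon-≡ e₀ ((a , e) ∷ p) with ≡-dec _≟_ e e₀
    ... | yes _ = coef-dropMon-≡ e₀ p
    ... | no e≢e₀ with ≡-dec _≟_ e e₀
    ...   | yes e≡e₀ = ⊥-elim (e≢e₀ e≡e₀)
    ...   | no  _    = coef-dropMon-≡ e₀ p

    coef-dropMon-≢ : ∀ {e e₀} (p : Poly n) → e ≢ e₀ → coef (dropMon e₀ p) e ≈ coef p e
    coef-dropMon-≢ [] _ = ≈-refl
    coef-dropMon-≢ {e} {e₀} ((a , e') ∷ p) e≢e₀ with ≡-dec _≟_ e' e₀
    ... | yes refl with ≡-dec _≟_ e' e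
    ...   | yes refl = ⊥-elim (e≢e₀ refl)
    ...   | no  _    = coef-dropMon-≢ p e≢e₀
    coef-dropMon-≢ {e} ((a , e') ∷ p) e≢e₀ | no _ with ≡-dec _≟_ e' e
    ...   | yes _ = +-congˡ (coef-dropMon-≢ p e≢e₀)
    ...   | no  _ = coef-dropMon-≢ p e≢e₀

    module _ (w : Fin n → ℕ) {d : ℕ} where

      ucoef-φ-dropMon : ∀ {e₀} (p : Poly n) → weight w e₀ ≡ d →
        ucoef (φ w p) d ≈ coef p e₀ + ucoef (φ w (dropMon e₀ p)) d
      ucoef-φ-dropMon [] _ = sym (+-identityʳ 0#)
      ucoef-φ-dropMon {e₀} ((a , e) ∷ p) w[e₀]≡d with ≡-dec _≟_ e e₀
      ... | yes refl with weight w e ≟ d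
      ...   | yes _ = begin
              a + ucoef (φ w p) d                                   ≈⟨ +-congˡ (ucoef-φ-dropMon p w[e₀]≡d) ⟩
              a + (coef p e + ucoef (φ w (dropMon e p)) d)         ≈⟨ +-assoc _ _ _ ⟨
              a + coef p e + ucoef (φ w (dropMon e p)) d           ∎
      ...   | no w[e]≢d = ⊥-elim (w[e]≢d w[e₀]≡d)
      ucoef-φ-dropMon {e₀} ((a , e) ∷ p) w[e₀]≡d | no _ with weight w e ≟ d
      ...   | yes _ = begin
              a + ucoef (φ w p) d                                   ≈⟨ +-congˡ (ucoef-φ-dropMon p w[e₀]≡d) ⟩
              a + (coef p e₀ + ucoef (φ w (dropMon e₀ p)) d)       ≈⟨ x∙yz≈y∙xz _ _ _ ⟩
              coef p e₀ + (a + ucoef (φ w (dropMon e₀ p)) d)       ∎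
      ...   | no _ = ucoef-φ-dropMon p w[e₀]≡d

      ucoef-φ-dropMon-≢ : ∀ {e₀} (p : Poly n) → weight w e₀ ≢ d →
        ucoef (φ w (dropMon e₀ p)) d ≈ ucoef (φ w p) d
      ucoef-φ-dropMon-≢ [] _ = ≈-refl
      ucoef-φ-dropMon-≢ {e₀} ((a , e) ∷ p) w[e₀]≢d with ≡-dec _≟_ e e₀
      ... | yes refl with weight w e ≟ d
      ...   | yes w[e]≡d = ⊥-elim (w[e₀]≢d w[e]≡d)
      ...   | no  _      = ucoef-φ-dropMon-≢ p w[e₀]≢d
      ucoef-φ-dropMon-≢ ((a , e) ∷ p) w[e₀]≢d | no _ with weight w e ≟ d
      ...   | yes _ = +-congˡ (ucoef-φ-dropMon-≢ p w[e₀]≢d)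
      ...   | no  _ = ucoef-φ-dropMon-≢ p w[e₀]≢d

      coef-dropMon-vanishes : ∀ {e₀} (p : Poly n) →
        (∀ e → weight w e ≡ d → e ≢ e₀ → coef p e ≈ 0#) →
        ∀ e → weight w e ≡ d → coef (dropMon e₀ p) e ≈ 0#
      coef-dropMon-vanishes {e₀} p vanish e w[e]≡d with ≡-dec _≟_ e e₀
      ... | yes refl = coef-dropMon-≡ e p
      ... | no e≢e₀  = trans (coef-dropMon-≢ p e≢e₀) (vanish e w[e]≡d e≢e₀)

      ucoef-φ-vanishes : ∀ (p : Poly n) → (∀ e → weight w e ≡ d → coef p e ≈ 0#) →
        ucoef (φ w p) d ≈ 0#
      ucoef-φ-vanishes p = go p (On.wellFounded length <-wellFounded p)
        where
        go : ∀ p → Acc (_<_ on length) p → (∀ e → weight w e ≡ d → coef p e ≈ 0#) →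
          ucoef (φ w p) d ≈ 0#
        go [] _ _ = ≈-refl
        go p@((a , e) ∷ q) (acc shorter) vanish = splitAtHead (weight w e ≟ d)
          where
          rest : ucoef (φ w (dropMon e p)) d ≈ 0#
          rest = go (dropMon e p) (shorter (length-dropMon-head a e q))
                    (coef-dropMon-vanishes p (λ e' w[e']≡d _ → vanish e' w[e']≡d))
          splitAtHead : Dec (weight w e ≡ d) → ucoef (φ w p) d ≈ 0#
          splitAtHead (yes w[e]≡d) = begin
            ucoef (φ w p) d                              ≈⟨ ucoef-φ-dropMon p w[e]≡d ⟩
            coef p e + ucoef (φ w (dropMon e p)) d      ≈⟨ +-cong (vanish e w[e]≡d) rest ⟩
            0# + 0#                                      ≈⟨ +-identityʳ 0# ⟩
            0#                                           ∎
          splitAtHead (no w[e]≢d) = trans (sym (ucoef-φ-dropMon-≢ p w[e]≢d)) rest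

    ucoef-φ-isolated : ∀ (w : Fin n → ℕ) (p : Poly n) m →
      (∀ e → weight w e ≡ weight w m → e ≢ m → coef p e ≈ 0#) →
      ucoef (φ w p) (weight w m) ≈ coef p m
    ucoef-φ-isolated w p m others = begin
      ucoef (φ w p) (weight w m)                               ≈⟨ ucoef-φ-dropMon w p refl ⟩
      coef p m + ucoef (φ w (dropMon m p)) (weight w m)       ≈⟨ +-congˡ (ucoef-φ-vanishes w (dropMon m p)
                                                                    (coef-dropMon-vanishes w p others)) ⟩
      coef p m + 0#                                            ≈⟨ +-identityʳ _ ⟩
      coef p m                                                 ∎

    IsZero⇒UIsZero-φ : ∀ (w : Fin n → ℕ) (p : Poly n) → IsZero p → UIsZero (φ w p)
    IsZero⇒UIsZero-φ w p p≈0 d = ucoef-φ-vanishes w p (λ e _ → p≈0 e)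

  linComb-vanishes : ∀ {s} {g : Fin s} {L : List (Vecᶠ s)} →
    All (λ u → u g ≈ 0#) L → ∀ cs → linComb L cs g ≈ 0#
  linComb-vanishes []             cs = ≈-refl
  linComb-vanishes {g = g} {u ∷ L} (u≈0 ∷ L≈0) cs = begin
    cs Fin.zero * u g + linComb L (λ i → cs (Fin.suc i)) g  ≈⟨ +-cong (trans (*-congˡ u≈0) (zeroʳ _))
                                                                        (linComb-vanishes L≈0 _) ⟩
    0# + 0#                                                  ≈⟨ +-identityʳ 0# ⟩
    0#                                                       ∎

  inSpan-vanishes : ∀ {s} {g : Fin s} {L : List (Vecᶠ s)} {u : Vecᶠ s} →
    All (λ u → u g ≈ 0#) L → InSpan L u → u g ≈ 0#
  inSpan-vanishes L≈0 (cs , u≈) = trans (u≈ _) (linComb-vanishes L≈0 cs)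

  UIsZero-φ⇒IsZero : ∀ {n s} (Ψ : Circuit n s) (w : Fin n → ℕ) (g : Fin s) →
    BasisIsolating Ψ w → UIsZero (φ w (eval Ψ g)) → IsZero (eval Ψ g)
  UIsZero-φ⇒IsZero {n} Ψ w g (M , (_ , spanned) , distinct , lighter) φf≈0 m =
    inSpan-vanishes (map⁺ (All.tabulate (λ m∈M → basis-vanishes _ (weight-wf _) m∈M))) (spanned m)
    where
    f : Poly n
    f = eval Ψ g

    open DecMembership (≡-dec {n = n} _≟_) using (_∈?_)

    weight-wf : WellFounded (_<_ on weight w)
    weight-wf = On.wellFounded (weight w) <-wellFounded

    basis-vanishes : ∀ m → Acc (_<_ on weight w) m → m ∈ M → coef f m ≈ 0#
    basis-vanishes m (acc lighter-vanishes) m∈M = begin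
      coef f m                      ≈⟨ ucoef-φ-isolated w f m others ⟨
      ucoef (φ w f) (weight w m)    ≈⟨ φf≈0 _ ⟩
      0#                            ∎
      where
      others : ∀ e → weight w e ≡ weight w m → e ≢ m → coef f e ≈ 0#
      others e w[e]≡w[m] e≢m with e ∈? M
      ... | yes e∈M = ⊥-elim (distinct e m e∈M m∈M e≢m w[e]≡w[m])
      ... | no  e∉M = inSpan-vanishes (map⁺ (All.tabulate lighterThan-e)) (lighter e e∉M)
        where
        lighterThan-e : ∀ {m'} → m' ∈ filter (λ m' → weight w m' <? weight w e) M → coef f m' ≈ 0#
        lighterThan-e {m'} m'∈ with ∈-filter⁻ (λ m' → weight w m' <? weight w e) m'∈
        ... | m'∈M , m'<e =
          basis-vanishes m' (lighter-vanishes (subst (weight w m' <_) w[e]≡w[m] m'<e)) m'∈M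

mainTheorem15 : ∀ {c ℓ : Level} (F : Field c ℓ) → let open FieldDefs F in
    ∀ (n s : ℕ) (Ψ : Circuit n s) (out : Fin s) (w : Fin n → ℕ) →
    BasisIsolating Ψ w →
    (¬ UIsZero (φ w (eval Ψ out))) ⇔ (¬ IsZero (eval Ψ out))
mainTheorem15 F n s Ψ out w isolating =
  mk⇔ (contraposition (IsZero⇒UIsZero-φ F w (FieldDefs.eval F Ψ out)))
      (contraposition (UIsZero-φ⇒IsZero F Ψ w out isolating))
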